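{- Let $G$ be a graph of order $n$, let $r=|S(G)|$, and let $t$ ($1\le t\le r$) be the minimum number such that every $t$-element subset $F\subseteq S(G)$ satisfies $N_{D(G)}(F)=V_s(G)$. Then $\mathrm{fxd}(G)=t+|V(G)\setminus S(G)|$.
   Context: Graphs are finite, simple, connected, with nontrivial automorphism group $\mathrm{Aut}(G)$ (standing assumption). For $S\subseteq V(G)$, $\mathrm{stab}(S)=\{g\in \mathrm{Aut}(G): g(v)=v \text{ for all } v\in S\}$; $S$ is a fixing set if $\mathrm{stab}(S)$ is trivial. $\mathrm{fxd}(G)$ is the minimum $k$ such that every $k$-element subset of $V(G)$ is a fixing set. Vertices $u,v$ are similar if $g(u)=v$ for some $g\in\mathrm{Aut}(G)$. $S(G)$ is the set of vertices similar to some vertex other than themselves; $V_s(G)$ is the set of pairs $(u,v)$ of distinct similar vertices of $G$ (regarded as unordered). For $F\subseteq S(G)$, $N_{D(G)}(F)=\{(x,y)\in V_s(G): \text{there is no } g\in\mathrm{stab}(F) \text{ with } g(x)=y\}$. -}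

module Defs where

open import Data.Nat using (ℕ; _≤_)
open import Data.Bool using (Bool; true; false)
open import Data.Fin using (Fin)
open import Data.Fin.Subset using (Subset; _∈_; ∣_∣; ∁)
open import Data.Product using (Σ; ∃; ∃-syntax; _×_; _,_)
open import Relation.Binary.PropositionalEquality using (_≡_; _≢_)
open import Relation.Nullary using (¬_)
open import Function.Definitions using (Bijective)

record Graph (n : ℕ) : Set where
  field
    Adj    : Fin n → Fin n → Bool
    sym    : ∀ u v → Adj u v ≡ Adj v u
    irrefl : ∀ v → Adj v v ≡ false

open Graph public

data Walk {n : ℕ} (G : Graph n) : Fin n → Fin n → Set where
  here : ∀ {v} → Walk G v v
  step : ∀ {u w v} → Adj G u w ≡ true → Walk G w v → Walk G u v

Connected : ∀ {n} → Graph n → Set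
Connected G = ∀ u v → Walk G u v

record Aut {n : ℕ} (G : Graph n) : Set where
  field
    fun       : Fin n → Fin n
    bijective : Bijective _≡_ _≡_ fun
    preserves : ∀ u v → Adj G u v ≡ Adj G (fun (u)) (fun v)

open Aut public

IsIdentity : ∀ {n} {G : Graph n} → Aut G → Set
IsIdentity g = ∀ v → fun g v ≡ v

NontrivialAut : ∀ {n} → Graph n → Set
NontrivialAut G = ∃[ g ] ¬ IsIdentity {G = G} g

InStab : ∀ {n} {G : Graph n} → Subset n → Aut G → Set
InStab S g = ∀ v → v ∈ S → fun g v ≡ v

FixingSet : ∀ {n} → Graph n → Subset n → Set
FixingSet G S = (g : Aut G) → InStab S g → IsIdentity g

AllFixing : ∀ {n} → Graph n → ℕ → Set
AllFixing {n} G k = (S : Subset n) → ∣ S ∣ ≡ k → FixingSet G S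

IsFxd : ∀ {n} → Graph n → ℕ → Set
IsFxd G k = AllFixing G k × (∀ k′ → AllFixing G k′ → k ≤ k′)

Similar : ∀ {n} → Graph n → Fin n → Fin n → Set
Similar G u v = ∃[ g ] fun {G = G} g u ≡ v

InSG : ∀ {n} → Graph n → Fin n → Set
InSG G v = ∃[ u ] (u ≢ v × Similar G v u)

IsSG : ∀ {n} → Graph n → Subset n → Set
IsSG {n} G SG = (v : Fin n) → (v ∈ SG → InSG G v) × (InSG G v → v ∈ SG)

SubsetOfSG : ∀ {n} → Graph n → Subset n → Set
SubsetOfSG {n} G F = (v : Fin n) → v ∈ F → InSG G v

InVs : ∀ {n} → Graph n → Fin n → Fin n → Set
InVs G x y = x ≢ y × Similar G x y

-- (x , y) ∈ N_{D(G)}(F): no g ∈ stab(F) with g(x) = y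
-- (for x y in V_s(G); N_D(F) is by definition a subset of V_s(G))
InND : ∀ {n} → Graph n → Subset n → Fin n → Fin n → Set
InND G F x y = ¬ (∃[ g ] (InStab {G = G} F g × fun g x ≡ y))

NDFull : ∀ {n} → Graph n → Subset n → Set
NDFull {n} G F = (x y : Fin n) → InVs G x y → InND G F x y

AllNDFull : ∀ {n} → Graph n → ℕ → Set
AllNDFull {n} G t = (F : Subset n) → SubsetOfSG G F → ∣ F ∣ ≡ t → NDFull G F

-- Every automorphism fixes the vertices outside S(G), so adding them to a set does not
-- shrink its stabiliser; and N_D(F) = V_s(G) says exactly that F is a fixing set. Hence a
-- set of size t + |V(G) ∖ S(G)| contains t vertices of S(G), which already fix G. Conversely,
-- if every k-set were fixing for some k < t + |V(G) ∖ S(G)|, then every (t − 1)-subset F of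
-- S(G) would be fixing (pad F ∪ (V(G) ∖ S(G)) down to k vertices), contradicting the
-- nontriviality of Aut(G) when t = 1 and the minimality of t otherwise.
module Submission where

open import Defs hiding (sym)
open import Data.Nat using (ℕ; zero; suc; _≤_; _+_; z≤n; s≤s; _≤?_)
open import Data.Nat.Properties
  using (≤-trans; ≤-reflexive; ≤-pred; n≤1+n; +-suc; +-monoʳ-≤; +-cancelʳ-≤; ≰⇒>; 1+n≰n)
open import Data.Vec using ([]; _∷_; here)
open import Data.Fin using (_≟_)
open import Data.Fin.Subset using (Subset; inside; outside; _∉_; _⊆_; ∣_∣; ∁; ⊥; _∩_; _∪_)
open import Data.Fin.Subset.Properties
  using (∉⊥; ⊥⊆; ⊆-trans; ∣⊥∣≡0; out⊆; in⊆in; drop-∷-⊆; p∩q⊆p; p∩q⊆q; x∈p∪q⁻; x∈∁p⇒x∉p)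
open import Data.Product using (∃-syntax; _×_; _,_; proj₁; proj₂)
open import Data.Sum using (inj₁; inj₂)
open import Data.Empty using (⊥-elim)
open import Function using (_∘_)
open import Relation.Nullary using (¬_; yes; no)
open import Relation.Binary.PropositionalEquality using (_≡_; refl; sym; trans; cong; module ≡-Reasoning)
open ≡-Reasoning

⊆-of-size : ∀ {n} (p : Subset n) {k} → k ≤ ∣ p ∣ → ∃[ q ] q ⊆ p × ∣ q ∣ ≡ k
⊆-of-size {n} p {zero} _ = ⊥ , ⊥⊆ , ∣⊥∣≡0 n
⊆-of-size (outside ∷ p) {suc k} k<∣p∣ with ⊆-of-size p k<∣p∣
... | q , q⊆p , ∣q∣≡ = outside ∷ q , out⊆ q⊆p , ∣q∣≡
⊆-of-size (inside ∷ p) {suc k} (s≤s k≤∣p∣) with ⊆-of-size p k≤∣p∣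
... | q , q⊆p , ∣q∣≡ = inside ∷ q , in⊆in q⊆p , cong suc ∣q∣≡

∣p∣≤∣p∩q∣+∣∁q∣ : ∀ {n} (p q : Subset n) → ∣ p ∣ ≤ ∣ p ∩ q ∣ + ∣ ∁ q ∣
∣p∣≤∣p∩q∣+∣∁q∣ []            []            = z≤n
∣p∣≤∣p∩q∣+∣∁q∣ (outside ∷ p) (outside ∷ q) =
  ≤-trans (∣p∣≤∣p∩q∣+∣∁q∣ p q) (+-monoʳ-≤ ∣ p ∩ q ∣ (n≤1+n ∣ ∁ q ∣))
∣p∣≤∣p∩q∣+∣∁q∣ (outside ∷ p) (inside  ∷ q) = ∣p∣≤∣p∩q∣+∣∁q∣ p q
∣p∣≤∣p∩q∣+∣∁q∣ (inside  ∷ p) (outside ∷ q) =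
  ≤-trans (s≤s (∣p∣≤∣p∩q∣+∣∁q∣ p q)) (≤-reflexive (sym (+-suc ∣ p ∩ q ∣ ∣ ∁ q ∣)))
∣p∣≤∣p∩q∣+∣∁q∣ (inside  ∷ p) (inside  ∷ q) = s≤s (∣p∣≤∣p∩q∣+∣∁q∣ p q)

p⊆q⇒∣p∪∁q∣≡∣p∣+∣∁q∣ : ∀ {n} {p q : Subset n} → p ⊆ q → ∣ p ∪ ∁ q ∣ ≡ ∣ p ∣ + ∣ ∁ q ∣
p⊆q⇒∣p∪∁q∣≡∣p∣+∣∁q∣ {p = []}          {[]}          _   = refl
p⊆q⇒∣p∪∁q∣≡∣p∣+∣∁q∣ {p = outside ∷ p} {outside ∷ q} p⊆q =
  trans (cong suc (p⊆q⇒∣p∪∁q∣≡∣p∣+∣∁q∣ (drop-∷-⊆ p⊆q))) (sym (+-suc ∣ p ∣ ∣ ∁ q ∣))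
p⊆q⇒∣p∪∁q∣≡∣p∣+∣∁q∣ {p = outside ∷ p} {inside  ∷ q} p⊆q = p⊆q⇒∣p∪∁q∣≡∣p∣+∣∁q∣ (drop-∷-⊆ p⊆q)
p⊆q⇒∣p∪∁q∣≡∣p∣+∣∁q∣ {p = inside  ∷ p} {outside ∷ q} p⊆q with p⊆q here
... | ()
p⊆q⇒∣p∪∁q∣≡∣p∣+∣∁q∣ {p = inside  ∷ p} {inside  ∷ q} p⊆q =
  cong suc (p⊆q⇒∣p∪∁q∣≡∣p∣+∣∁q∣ (drop-∷-⊆ p⊆q))

module _ {n : ℕ} (G : Graph n) where

  SubsetOfSG⇒⊆ : ∀ {SG F} → IsSG G SG → SubsetOfSG G F → F ⊆ SG
  SubsetOfSG⇒⊆ isSG F⊆S v∈F = proj₂ (isSG _) (F⊆S _ v∈F)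

  ⊆⇒SubsetOfSG : ∀ {SG F} → IsSG G SG → F ⊆ SG → SubsetOfSG G F
  ⊆⇒SubsetOfSG isSG F⊆SG v v∈F = proj₁ (isSG v) (F⊆SG v∈F)

  Aut-fixes-∉SG : ∀ {SG} → IsSG G SG → (g : Aut G) → ∀ {v} → v ∉ SG → fun g v ≡ v
  Aut-fixes-∉SG isSG g {v} v∉SG with fun g v ≟ v
  ... | yes gv≡v = gv≡v
  ... | no  gv≢v = ⊥-elim (v∉SG (proj₂ (isSG v) (fun g v , gv≢v , g , refl)))

  NDFull⇒FixingSet : ∀ {F} → NDFull G F → FixingSet G F
  NDFull⇒FixingSet nd g g∈stab v with fun g v ≟ v
  ... | yes gv≡v = gv≡v
  ... | no  gv≢v = ⊥-elim (nd v (fun g v) ((λ v≡gv → gv≢v (sym v≡gv)) , g , refl) (g , g∈stab , refl))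

  FixingSet⇒NDFull : ∀ {F} → FixingSet G F → NDFull G F
  FixingSet⇒NDFull fixing x y (x≢y , _) (g , g∈stab , gx≡y) = x≢y (trans (sym (fixing g g∈stab x)) gx≡y)

  FixingSet-⊆ : ∀ {F S} → F ⊆ S → FixingSet G F → FixingSet G S
  FixingSet-⊆ F⊆S fixing g g∈stab = fixing g (λ v v∈F → g∈stab v (F⊆S v∈F))

  FixingSet-∪∁SG⇒ : ∀ {SG F} → IsSG G SG → FixingSet G (F ∪ ∁ SG) → FixingSet G F
  FixingSet-∪∁SG⇒ {SG} {F} isSG fixing g g∈stab = fixing g fixes-F∪∁SG
    where
      fixes-F∪∁SG : InStab (F ∪ ∁ SG) g
      fixes-F∪∁SG v v∈ with x∈p∪q⁻ F (∁ SG) v∈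
      ... | inj₁ v∈F   = g∈stab v v∈F
      ... | inj₂ v∈∁SG = Aut-fixes-∉SG isSG g (x∈∁p⇒x∉p v∈∁SG)

  AllFixing⇒FixingSet : ∀ {k S} → AllFixing G k → k ≤ ∣ S ∣ → FixingSet G S
  AllFixing⇒FixingSet {S = S} all-k k≤∣S∣ with ⊆-of-size S k≤∣S∣
  ... | T , T⊆S , ∣T∣≡k = FixingSet-⊆ T⊆S (all-k T ∣T∣≡k)

  NontrivialAut⇒¬AllNDFull-0 : NontrivialAut G → ¬ AllNDFull G 0
  NontrivialAut⇒¬AllNDFull-0 (g , g≢id) all-0 =
    g≢id (NDFull⇒FixingSet (all-0 ⊥ (λ _ → ⊥-elim ∘ ∉⊥) (∣⊥∣≡0 n)) g (λ _ → ⊥-elim ∘ ∉⊥))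

  ¬AllNDFull-below-minimum : ∀ (SG : Subset n) {m} → NontrivialAut G → suc m ≤ ∣ SG ∣ →
                             (∀ t′ → 1 ≤ t′ → t′ ≤ ∣ SG ∣ → AllNDFull G t′ → suc m ≤ t′) →
                             ¬ AllNDFull G m
  ¬AllNDFull-below-minimum _ {zero}   nontrivial _      _       = NontrivialAut⇒¬AllNDFull-0 nontrivial
  ¬AllNDFull-below-minimum _ {suc m′} _          m<∣SG∣ minimal all-m =
    1+n≰n (minimal (suc m′) (s≤s z≤n) (≤-trans (n≤1+n _) m<∣SG∣) all-m)

  AllNDFull⇒FixingSet : ∀ {SG t S} → IsSG G SG → AllNDFull G t → t ≤ ∣ S ∩ SG ∣ → FixingSet G S
  AllNDFull⇒FixingSet {SG} {S = S} isSG all-t t≤∣S∩SG∣ with ⊆-of-size (S ∩ SG) t≤∣S∩SG∣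
  ... | F , F⊆S∩SG , ∣F∣≡t =
    FixingSet-⊆ (⊆-trans F⊆S∩SG (p∩q⊆p S SG))
      (NDFull⇒FixingSet (all-t F (⊆⇒SubsetOfSG isSG (⊆-trans F⊆S∩SG (p∩q⊆q S SG))) ∣F∣≡t))

  AllNDFull⇒AllFixing : ∀ {SG t} → IsSG G SG → AllNDFull G t → AllFixing G (t + ∣ ∁ SG ∣)
  AllNDFull⇒AllFixing {SG} {t} isSG all-t S ∣S∣≡t+c = AllNDFull⇒FixingSet isSG all-t
    (+-cancelʳ-≤ (∣ ∁ SG ∣) t (∣ S ∩ SG ∣) (≤-trans (≤-reflexive (sym ∣S∣≡t+c)) (∣p∣≤∣p∩q∣+∣∁q∣ S SG)))

  AllFixing⇒AllNDFull : ∀ {SG k m} → IsSG G SG → AllFixing G k → k ≤ m + ∣ ∁ SG ∣ → AllNDFull G m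
  AllFixing⇒AllNDFull {SG} {k} {m} isSG all-k k≤m+c F F⊆SG ∣F∣≡m =
    FixingSet⇒NDFull (FixingSet-∪∁SG⇒ isSG (AllFixing⇒FixingSet all-k k≤∣F∪∁SG∣))
    where
      k≤∣F∪∁SG∣ : k ≤ ∣ F ∪ ∁ SG ∣
      k≤∣F∪∁SG∣ = ≤-trans k≤m+c (≤-reflexive (begin
        m + ∣ ∁ SG ∣     ≡⟨ cong (_+ ∣ ∁ SG ∣) (sym ∣F∣≡m) ⟩
        ∣ F ∣ + ∣ ∁ SG ∣ ≡⟨ sym (p⊆q⇒∣p∪∁q∣≡∣p∣+∣∁q∣ (SubsetOfSG⇒⊆ isSG F⊆SG)) ⟩
        ∣ F ∪ ∁ SG ∣     ∎))

theorem7 : (n : ℕ) (G : Graph n) → Connected G → NontrivialAut G →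
           (SG : Subset n) → IsSG G SG →
           (t : ℕ) → 1 ≤ t → t ≤ ∣ SG ∣ → AllNDFull G t →
           (∀ t′ → 1 ≤ t′ → t′ ≤ ∣ SG ∣ → AllNDFull G t′ → t ≤ t′) →
           IsFxd G (t + ∣ ∁ SG ∣)
theorem7 n G _ nontrivial SG isSG (suc m) _ t≤∣SG∣ all-t minimal =
  AllNDFull⇒AllFixing G isSG all-t , lower-bound
  where
    lower-bound : ∀ k → AllFixing G k → suc m + ∣ ∁ SG ∣ ≤ k
    lower-bound k all-k with suc m + ∣ ∁ SG ∣ ≤? k
    ... | yes t+c≤k = t+c≤k
    ... | no  t+c≰k = ⊥-elim (¬AllNDFull-below-minimum G SG nontrivial t≤∣SG∣ minimal
                        (AllFixing⇒AllNDFull G isSG all-k (≤-pred (≰⇒> t+c≰k))))
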